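{- For every ordered graph $(G,\prec)$ and positive integers $d,t$, if $\Delta(G)\leqslant d$ and $\mathrm{stw}(G,\prec)\leqslant t$, then $\mathrm{Ov}(G,\prec)$ does not contain $K_{N,N}$ as a subgraph, where $N=4td^2$.
   Context: An ordered graph $(G,\prec)$ is a finite simple graph with a strict total order $\prec$ on $V(G)$. For an edge $e$, $L(e)$ and $R(e)$ denote its $\prec$-smaller and $\prec$-larger endpoint. Edges $e,f$ cross if $L(e)\prec L(f)\prec R(e)\prec R(f)$ or $L(f)\prec L(e)\prec R(f)\prec R(e)$. The overlap graph $\mathrm{Ov}(G,\prec)$ has vertex set $E(G)$ and an edge between any two crossing edges. Subgraphs need not be induced. A partition sequence of an $n$-vertex graph $G$ is a sequence $\mathcal P_n,\dots,\mathcal P_1$ of partitions of $V(G)$ with $\mathcal P_n$ the singleton partition, $\mathcal P_1=\{V(G)\}$, each obtained from the previous by merging two parts. Distinct parts $X,Y$ are inhomogeneous if there are $u,u'\in X$, $v,v'\in Y$ with $uv\in E(G)$, $u'v'\notin E(G)$; the red graph $\mathcal R(\mathcal P)$ has vertex set $\mathcal P$ and edges between inhomogeneous parts. The span of $X\subseteq V(G)$ is $\langle X\rangle=\{v:\min X\preceq v\preceq\max X\}$; $X,Y$ conflict if their spans intersect. For $X\in\mathcal P$, $Y\in\mathcal P\setminus\{X\}$ interferes with $X$ if $Y$ conflicts with the union of the parts in the closed neighborhood of $X$ in $\mathcal R(\mathcal P)$; the stretch of $X$ is the number of parts interfering with it; the stretch of $\mathcal P$ is the maximum over parts. $\mathrm{stw}(G,\prec)$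 is the minimum over partition sequences of the maximum stretch of its partitions. -}

module Defs where

open import Data.Nat using (ℕ; zero; suc; _+_; _*_; _^_; _≤_; _<_)
open import Data.Fin using (Fin; _≟_) renaming (_<_ to _<ᶠ_; _≤_ to _≤ᶠ_; _≤?_ to _≤ᶠ?_)
open import Data.Bool using (Bool; true; false; _∧_; _∨_; not; if_then_else_)
open import Data.List using (List; map; allFin)
open import Data.Bool.ListAction using (any)
open import Data.Nat.ListAction using (sum)
open import Data.Product using (Σ; ∃; ∃-syntax; _×_; _,_)
open import Data.Sum using (_⊎_)
open import Relation.Nullary using (¬_)
open import Relation.Nullary.Decidable using (⌊_⌋)
open import Relation.Binary.PropositionalEquality using (_≡_; _≢_)
open import Function.Bundles using (_⇔_)

-- Ordered graphs: vertex set Fin n, ordered by the usual order on Fin n.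
-- (Every finite strict total order is isomorphic to this one.)

record OGraph (n : ℕ) : Set where
  field
    adj    : Fin n → Fin n → Bool
    sym    : ∀ u v → adj u v ≡ adj v u
    irrefl : ∀ v → adj v v ≡ false
open OGraph public

anyF : ∀ {m} → (Fin m → Bool) → Bool
anyF {m} f = any f (allFin m)

countF : ∀ {m} → (Fin m → Bool) → ℕ
countF {m} f = sum (map (λ x → if f x then 1 else 0) (allFin m))

eqF : ∀ {m} → Fin m → Fin m → Bool
eqF i j = ⌊ i ≟ j ⌋

leF : ∀ {m} → Fin m → Fin m → Bool
leF i j = ⌊ i ≤ᶠ? j ⌋

degree : ∀ {n} → OGraph n → Fin n → ℕ
degree G v = countF (λ u → adj G v u)

MaxDegreeAtMost : ∀ {n} → OGraph n → ℕ → Set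
MaxDegreeAtMost G d = ∀ v → degree G v ≤ d

record Edge {n : ℕ} (G : OGraph n) : Set where
  constructor edge
  field
    L    : Fin n
    R    : Fin n
    L<R  : L <ᶠ R
    isE  : adj G L R ≡ true
open Edge public

SameEdge : ∀ {n} {G : OGraph n} → Edge G → Edge G → Set
SameEdge e f = (L e ≡ L f) × (R e ≡ R f)

Cross : ∀ {n} {G : OGraph n} → Edge G → Edge G → Set
Cross e f = (L e <ᶠ L f × L f <ᶠ R e × R e <ᶠ R f)
          ⊎ (L f <ᶠ L e × L e <ᶠ R f × R f <ᶠ R e)

-- Ov(G,≺) contains K_{N,N} as a (not necessarily induced) subgraph:
-- 2N pairwise distinct edges a_1..a_N, b_1..b_N with every a_i crossing every b_j.
OvContainsKNN : ∀ {n} → OGraph n → ℕ → Set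
OvContainsKNN G N =
  Σ (Fin N → Edge G) λ a → Σ (Fin N → Edge G) λ b →
      (∀ i j → SameEdge (a i) (a j) → i ≡ j)
    × (∀ i j → SameEdge (b i) (b j) → i ≡ j)
    × (∀ i j → ¬ SameEdge (a i) (b j))
    × (∀ i j → Cross (a i) (b j))

-- Partitions: a partition of V(G) into m parts is a labelling
-- p : Fin n → Fin m (surjectivity is imposed in the sequence);
-- part i = { v | p v = i }.

module _ {n : ℕ} (G : OGraph n) {m : ℕ} (p : Fin n → Fin m) where

  inPart : Fin m → Fin n → Bool
  inPart i v = eqF (p v) i

  inhom : Fin m → Fin m → Bool
  inhom i j = not (eqF i j) ∧
    anyF (λ u → anyF (λ u' → anyF (λ v → anyF (λ v' →
      inPart i u ∧ inPart i u' ∧ inPart j v ∧ inPart j v'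
      ∧ adj G u v ∧ not (adj G u' v')))))

  -- union of the parts in the closed red neighbourhood of X_i
  closedNbhdUnion : Fin m → Fin n → Bool
  closedNbhdUnion i v = eqF (p v) i ∨ inhom i (p v)

  inSpan : (Fin n → Bool) → Fin n → Bool
  inSpan S w = anyF (λ a → anyF (λ b → S a ∧ S b ∧ leF a w ∧ leF w b))

  conflict : (Fin n → Bool) → (Fin n → Bool) → Bool
  conflict S T = anyF (λ w → inSpan S w ∧ inSpan T w)

  -- Y = X_j interferes with X = X_i
  interferes : Fin m → Fin m → Bool
  interferes i j = not (eqF i j) ∧ conflict (inPart j) (closedNbhdUnion i)

  stretchOf : Fin m → ℕ
  stretchOf i = countF (interferes i)

-- Partition sequences.  part k is the partition P_{k+1} (with k+1 parts),
-- meaningful for k < n.  P_1 has a single part automatically (Fin 1).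

record PartitionSeq {n : ℕ} (G : OGraph n) : Set where
  field
    part   : (k : ℕ) → Fin n → Fin (suc k)
    surj   : ∀ k → k < n → ∀ (i : Fin (suc k)) → ∃[ v ] part k v ≡ i
    finest : ∀ k → suc k ≡ n → ∀ u v → part k u ≡ part k v → u ≡ v
    merge  : ∀ k → suc k < n →
             Σ (Fin (suc (suc k))) λ a → Σ (Fin (suc (suc k))) λ b → a ≢ b ×
             (∀ u v → (part k u ≡ part k v) ⇔
                ((part (suc k) u ≡ part (suc k) v)
                 ⊎ (((part (suc k) u ≡ a) ⊎ (part (suc k) u ≡ b))
                    × ((part (suc k) v ≡ a) ⊎ (part (suc k) v ≡ b)))))
open PartitionSeq public

StwAtMost : ∀ {n} → OGraph n → ℕ → Set
StwAtMost {n} G t = Σ (PartitionSeq G) λ S →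
  ∀ k → k < n → ∀ (i : Fin (suc k)) → stretchOf G (part S k) i ≤ t

-- Call an edge unresolved at a partition when its endpoints lie in one part or in two
-- inhomogeneous parts.  Every edge is unresolved in the one-part partition and none in the
-- partition into singletons, so along the partition sequence there is a last partition P in
-- which some edge e of the biclique is unresolved; the N edges on the other side cross e and
-- are all resolved in the next, finer partition P'.  Each of them has an endpoint strictly
-- inside the span of e, and the part of P containing it conflicts with the closed red
-- neighbourhood of the part of L(e): these endpoints meet at most t + 1 parts of P, hence at
-- most t + 2 parts of P'.  The other endpoint of a resolved edge is adjacent to the whole
-- P'-part of its inner endpoint, so a part of P' holds at most d inner endpoints, and a vertex
-- is the inner endpoint of at most d of the edges.  So N ≤ (t + 2) d² < 4 t d².
module Submission where

open import Defs hiding (sym)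
open import Data.Nat using (ℕ; zero; suc; _+_; _*_; _^_; _≤_; _<_; z≤n; s≤s)
open import Data.Nat.Properties
  using ( +-*-semiring; module ≤-Reasoning; ≤-refl; ≤-trans; ≤-reflexive; <⇒≤; <⇒≱
        ; m≤n⇒m≤1+n; n≤0⇒n≡0; m≤m+n; +-mono-≤; +-monoʳ-<; *-monoʳ-≤; *-monoˡ-<; *-identityˡ; *-identityʳ )
open import Data.Nat.Tactic.RingSolver using (solve-∀)
open import Data.Fin using (Fin; zero; suc; _≟_) renaming (_<_ to _<ᶠ_; _≤_ to _≤ᶠ_; _≤?_ to _≤ᶠ?_)
import Data.Fin.Properties as Fin
open import Data.Bool using (Bool; true; false; T; _∧_; _∨_; not; if_then_else_)
open import Data.Bool.Properties using (T-∧; T-∨; T?)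
open import Data.List using (tabulate; allFin)
import Data.Nat.ListAction as List
open import Data.List.Properties using (map-tabulate)
open import Data.List.Relation.Unary.Any using (satisfied)
open import Data.List.Relation.Unary.Any.Properties using (any⁺; any⁻)
open import Data.List.Membership.Propositional using (lose)
open import Data.List.Membership.Propositional.Properties using (∈-allFin)
open import Data.Product using (∃-syntax; _×_; _,_; proj₁; proj₂)
open import Data.Sum using (_⊎_; inj₁; inj₂; [_,_])
open import Data.Empty using (⊥-elim)
open import Function using (_∘_; id)
open import Function.Bundles using (Equivalence; _⇔_)
open import Relation.Nullary using (¬_; yes; no)
open import Relation.Nullary.Decidable using (toWitness; fromWitness)
open import Relation.Binary.PropositionalEquality
  using (_≡_; _≢_; refl; sym; trans; cong; subst; subst₂)
open import Algebra.Properties.Semiring.Sum +-*-semiring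
  using (sum; sum-syntax; sum-cong-≗; sum-remove; sum-replicate-zero; ∑-comm; ∑-distrib-+; *-distribˡ-sum)

∧-intro : ∀ {a b} → T a → T b → T (a ∧ b)
∧-intro ta tb = Equivalence.from T-∧ (ta , tb)

T-∧⁻ : ∀ {a b} → T (a ∧ b) → T a × T b
T-∧⁻ = Equivalence.to T-∧

T-∨⁺ : ∀ {a b} → T a ⊎ T b → T (a ∨ b)
T-∨⁺ = Equivalence.from T-∨

T-∨⁻ : ∀ {a b} → T (a ∨ b) → T a ⊎ T b
T-∨⁻ = Equivalence.to T-∨

T-not⁺ : ∀ {b} → ¬ T b → T (not b)
T-not⁺ {false} _ = _
T-not⁺ {true} ¬tt = ¬tt _

T-not⁻ : ∀ {b} → T (not b) → ¬ T b
T-not⁻ {false} _ ()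

anyF⁺ : ∀ {m} (f : Fin m → Bool) x → T (f x) → T (anyF f)
anyF⁺ f x fx = any⁺ f (lose (∈-allFin x) fx)

anyF⁻ : ∀ {m} (f : Fin m → Bool) → T (anyF f) → ∃[ x ] T (f x)
anyF⁻ f h = satisfied (any⁻ f (allFin _) h)

eqF⁺ : ∀ {m} {x y : Fin m} → x ≡ y → T (eqF x y)
eqF⁺ {x = x} {y} = fromWitness {a? = x ≟ y}

eqF⁻ : ∀ {m} {x y : Fin m} → T (eqF x y) → x ≡ y
eqF⁻ {x = x} {y} = toWitness {a? = x ≟ y}

leF⁺ : ∀ {m} {x y : Fin m} → x ≤ᶠ y → T (leF x y)
leF⁺ {x = x} {y} = fromWitness {a? = x ≤ᶠ? y}

indicator : Bool → ℕ
indicator b = if b then 1 else 0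

count : ∀ {m} → (Fin m → Bool) → ℕ
count {m} P = ∑[ x < m ] indicator (P x)

countF≡count : ∀ {m} (P : Fin m → Bool) → countF P ≡ count P
countF≡count {m} P = trans (cong List.sum (map-tabulate id (indicator ∘ P))) (listSum≡∑ (indicator ∘ P))
  where
  listSum≡∑ : ∀ {k} (f : Fin k → ℕ) → List.sum (tabulate f) ≡ sum f
  listSum≡∑ {zero} f = refl
  listSum≡∑ {suc k} f = cong (f zero +_) (listSum≡∑ (f ∘ suc))

∑-mono-≤ : ∀ {m} {f g : Fin m → ℕ} → (∀ x → f x ≤ g x) → sum f ≤ sum g
∑-mono-≤ {zero} f≤g = z≤n
∑-mono-≤ {suc m} f≤g = +-mono-≤ (f≤g zero) (∑-mono-≤ (f≤g ∘ suc))

≤-∑ : ∀ {m} (f : Fin m → ℕ) x → f x ≤ sum f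
≤-∑ {suc m} f x = ≤-trans (m≤m+n (f x) _) (≤-reflexive (sym (sum-remove {i = x} f)))

count-all : ∀ m → count {m} (λ _ → true) ≡ m
count-all zero = refl
count-all (suc m) = cong suc (count-all m)

indicator-mono : ∀ {a b} → (T a → T b) → indicator a ≤ indicator b
indicator-mono {false} _ = z≤n
indicator-mono {true} {true} _ = ≤-refl
indicator-mono {true} {false} a⇒b = ⊥-elim (a⇒b _)

count-none : ∀ {m} (P : Fin m → Bool) → (∀ x → ¬ T (P x)) → count P ≡ 0
count-none {m} P none =
  trans (sum-cong-≗ (λ x → n≤0⇒n≡0 (indicator-mono {b = false} (none x)))) (sum-replicate-zero m)

count-mono : ∀ {m} {P Q : Fin m → Bool} → (∀ x → T (P x) → T (Q x)) → count P ≤ count Q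
count-mono P⊆Q = ∑-mono-≤ (λ x → indicator-mono (P⊆Q x))

count-cover : ∀ {m} {P Q R : Fin m → Bool} → (∀ x → T (P x) → T (Q x) ⊎ T (R x)) →
  count P ≤ count Q + count R
count-cover {P = P} {Q} {R} cover =
  ≤-trans (∑-mono-≤ pointwise) (≤-reflexive (∑-distrib-+ (indicator ∘ Q) (indicator ∘ R)))
  where
  pointwise : ∀ x → indicator (P x) ≤ indicator (Q x) + indicator (R x)
  pointwise x with P x | Q x | R x | cover x
  ... | false | _ | _ | _ = z≤n
  ... | true | true | _ | _ = s≤s z≤n
  ... | true | false | true | _ = ≤-refl
  ... | true | false | false | coverx with coverx _
  ...   | inj₁ ()
  ...   | inj₂ ()

count-≤-witness : ∀ {m} {P : Fin m → Bool} {c} → (∀ x → T (P x) → count P ≤ c) → count P ≤ c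
count-≤-witness {zero} _ = z≤n
count-≤-witness {suc m} {P} {c} bound with P zero in eq
... | true = bound zero (subst T (sym eq) _)
... | false = count-≤-witness {P = P ∘ suc} (λ x → bound (suc x))

count-unique : ∀ {m} {P : Fin m → Bool} → (∀ x y → T (P x) → T (P y) → x ≡ y) → count P ≤ 1
count-unique {zero} _ = z≤n
count-unique {suc m} {P} unique with P zero in eq
... | true = ≤-reflexive (cong suc (count-none (P ∘ suc)
                 λ x Px → Fin.0≢1+n (unique zero (suc x) (subst T (sym eq) _) Px)))
... | false = count-unique {P = P ∘ suc} (λ x y Px Py → Fin.suc-injective (unique (suc x) (suc y) Px Py))

indicator-T : ∀ {b} → T b → indicator b ≡ 1
indicator-T {true} _ = refl

count-fibres : ∀ {a b} {P : Fin a → Bool} {Q : Fin b → Bool} (g : Fin a → Fin b) {c} →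
  (∀ x → T (P x) → T (Q (g x))) →
  (∀ x → T (P x) → count (λ x' → P x' ∧ eqF (g x') (g x)) ≤ c) →
  count P ≤ c * count Q
count-fibres {a} {b} {P} {Q} g {c} P⇒Qg fibre≤c = begin
  count P                            ≤⟨ ∑-mono-≤ inFibre ⟩
  ∑[ x < a ] ∑[ y < b ] fibre x y    ≡⟨ ∑-comm fibre ⟩
  ∑[ y < b ] ∑[ x < a ] fibre x y    ≤⟨ ∑-mono-≤ (λ y → count-≤-witness (fibre≤ y)) ⟩
  ∑[ y < b ] (c * indicator (Q y))   ≡⟨ sym (*-distribˡ-sum c (indicator ∘ Q)) ⟩
  c * count Q                        ∎
  where
  open ≤-Reasoning
  fibre : Fin a → Fin b → ℕ
  fibre x y = indicator (P x ∧ eqF (g x) y)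
  inFibre : ∀ x → indicator (P x) ≤ ∑[ y < b ] fibre x y
  inFibre x = ≤-trans (indicator-mono (λ Px → ∧-intro Px (eqF⁺ {x = g x} refl))) (≤-∑ (fibre x) (g x))
  fibre≤ : ∀ y x → T (P x ∧ eqF (g x) y) → ∑[ x' < a ] fibre x' y ≤ c * indicator (Q y)
  fibre≤ y x x∈y with T-∧⁻ {P x} x∈y
  ... | Px , gx≡y with eqF⁻ {x = g x} {y} gx≡y
  ... | refl = ≤-trans (fibre≤c x Px)
                 (≤-reflexive (sym (trans (cong (c *_) (indicator-T (P⇒Qg x Px))) (*-identityʳ c))))

count-injective : ∀ {a b} {P : Fin a → Bool} {Q : Fin b → Bool} (g : Fin a → Fin b) →
  (∀ x → T (P x) → T (Q (g x))) →
  (∀ x y → T (P x) → T (P y) → g x ≡ g y → x ≡ y) →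
  count P ≤ count Q
count-injective {P = P} {Q} g P⇒Qg injective =
  ≤-trans (count-fibres g P⇒Qg fibre≤1) (≤-reflexive (*-identityˡ (count Q)))
  where
  fibre≤1 : ∀ x → T (P x) → count (λ x' → P x' ∧ eqF (g x') (g x)) ≤ 1
  fibre≤1 x _ = count-unique λ y z y∈ z∈ →
    let (Py , gy≡gx) = T-∧⁻ {P y} y∈
        (Pz , gz≡gx) = T-∧⁻ {P z} z∈
    in injective y z Py Pz (trans (eqF⁻ gy≡gx) (sym (eqF⁻ gz≡gx)))

count-∘-injective-off : ∀ {a b} (σ : Fin a → Fin b) (β : Fin a) →
  (∀ x y → x ≢ β → y ≢ β → σ x ≡ σ y → x ≡ y) →
  (P : Fin b → Bool) → count (P ∘ σ) ≤ 1 + count P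
count-∘-injective-off {a} σ β injective P =
  ≤-trans (count-cover {Q = λ x → eqF x β} {R = awayFromβ} split)
          (+-mono-≤ (count-unique {P = λ x → eqF x β} (λ x y x≡β y≡β → trans (eqF⁻ x≡β) (sym (eqF⁻ y≡β))))
                    (count-injective σ (λ x away → proj₁ (T-∧⁻ {P (σ x)} away)) injectiveAway))
  where
  awayFromβ : Fin a → Bool
  awayFromβ x = P (σ x) ∧ not (eqF x β)
  split : ∀ x → T (P (σ x)) → T (eqF x β) ⊎ T (awayFromβ x)
  split x Pσx with T? (eqF x β)
  ... | yes x≡β = inj₁ x≡β
  ... | no x≢β = inj₂ (∧-intro Pσx (T-not⁺ x≢β))
  away⇒≢β : ∀ x → T (awayFromβ x) → x ≢ β
  away⇒≢β x away = T-not⁻ (proj₂ (T-∧⁻ {P (σ x)} away)) ∘ eqF⁺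
  injectiveAway : ∀ x y → T (awayFromβ x) → T (awayFromβ y) → σ x ≡ σ y → x ≡ y
  injectiveAway x y x-away y-away = injective x y (away⇒≢β x x-away) (away⇒≢β y y-away)

module _ {n} (G : OGraph n) where

  adjacent : Fin n → Fin n → Set
  adjacent u v = T (adj G u v)

  adjacent-sym : ∀ {u v} → adjacent u v → adjacent v u
  adjacent-sym {u} {v} = subst T (OGraph.sym G u v)

  edge-adjacent : (e : Edge G) → adjacent (L e) (R e)
  edge-adjacent e = subst T (sym (isE e)) _

module Crossing {n} {G : OGraph n} (e : Edge G) where

  inner : (f : Edge G) → Cross e f → Fin n
  inner f (inj₁ _) = L f
  inner f (inj₂ _) = R f

  outer : (f : Edge G) → Cross e f → Fin n
  outer f (inj₁ _) = R f
  outer f (inj₂ _) = L f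

  inner-inside : ∀ f (c : Cross e f) → L e <ᶠ inner f c × inner f c <ᶠ R e
  inner-inside f (inj₁ (Le<Lf , Lf<Re , _)) = Le<Lf , Lf<Re
  inner-inside f (inj₂ (_ , Le<Rf , Rf<Re)) = Le<Rf , Rf<Re

  inner-outer-adjacent : ∀ f (c : Cross e f) → adjacent G (inner f c) (outer f c)
  inner-outer-adjacent f (inj₁ _) = edge-adjacent G f
  inner-outer-adjacent f (inj₂ _) = adjacent-sym G (edge-adjacent G f)

  inner-outer-injective : ∀ f f' (c : Cross e f) (c' : Cross e f') →
    inner f c ≡ inner f' c' → outer f c ≡ outer f' c' → SameEdge f f'
  inner-outer-injective f f' (inj₁ _) (inj₁ _) ≡L ≡R = ≡L , ≡R
  inner-outer-injective f f' (inj₂ _) (inj₂ _) ≡R ≡L = ≡L , ≡R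
  inner-outer-injective f f' (inj₁ _) (inj₂ _) Lf≡Rf' Rf≡Lf' =
    ⊥-elim (Fin.<-asym (L<R f') (subst₂ _<ᶠ_ Lf≡Rf' Rf≡Lf' (L<R f)))
  inner-outer-injective f f' (inj₂ _) (inj₁ _) Rf≡Lf' Lf≡Rf' =
    ⊥-elim (Fin.<-asym (L<R f') (subst₂ _<ᶠ_ Lf≡Rf' Rf≡Lf' (L<R f)))

cross-sym : ∀ {n} {G : OGraph n} {e f : Edge G} → Cross e f → Cross f e
cross-sym (inj₁ c) = inj₂ c
cross-sym (inj₂ c) = inj₁ c

module _ {n} (G : OGraph n) {m} (p : Fin n → Fin m) where

  InhomWitness : Fin m → Fin m → Set
  InhomWitness i j = ∃[ u ] ∃[ u' ] ∃[ v ] ∃[ v' ]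
    p u ≡ i × p u' ≡ i × p v ≡ j × p v' ≡ j × adjacent G u v × ¬ adjacent G u' v'

  inhom⁺ : ∀ {i j} → i ≢ j → InhomWitness i j → T (inhom G p i j)
  inhom⁺ i≢j (u , u' , v , v' , u∈ , u'∈ , v∈ , v'∈ , uv , ¬u'v') =
    ∧-intro (T-not⁺ (i≢j ∘ eqF⁻))
      (anyF⁺ _ u (anyF⁺ _ u' (anyF⁺ _ v (anyF⁺ _ v'
        (∧-intro (eqF⁺ u∈) (∧-intro (eqF⁺ u'∈) (∧-intro (eqF⁺ v∈) (∧-intro (eqF⁺ v'∈)
          (∧-intro uv (T-not⁺ ¬u'v'))))))))))

  inhom⁻ : ∀ {i j} → T (inhom G p i j) → InhomWitness i j
  inhom⁻ h =
    let (_ , some) = T-∧⁻ h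
        (u , h₁) = anyF⁻ _ some
        (u' , h₂) = anyF⁻ _ h₁
        (v , h₃) = anyF⁻ _ h₂
        (v' , h₄) = anyF⁻ _ h₃
        (u∈ , h₅) = T-∧⁻ h₄
        (u'∈ , h₆) = T-∧⁻ h₅
        (v∈ , h₇) = T-∧⁻ h₆
        (v'∈ , h₈) = T-∧⁻ h₇
        (uv , ¬u'v') = T-∧⁻ h₈
    in u , u' , v , v' , eqF⁻ u∈ , eqF⁻ u'∈ , eqF⁻ v∈ , eqF⁻ v'∈ , uv , T-not⁻ ¬u'v'

  unresolved : Edge G → Bool
  unresolved e = closedNbhdUnion G p (p (L e)) (R e)

  resolved⇒complete : ∀ f → ¬ T (unresolved f) →
    ∀ {u v} → p u ≡ p (L f) → p v ≡ p (R f) → adjacent G u v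
  resolved⇒complete f resolved {u} {v} u∈ v∈ with adj G u v in uv
  ... | true = _
  ... | false = resolved (T-∨⁺ (inj₂ (inhom⁺ distinct
          (L f , u , R f , v , refl , u∈ , refl , v∈ , edge-adjacent G f , subst T uv))))
    where
    distinct : p (L f) ≢ p (R f)
    distinct same = resolved (T-∨⁺ (inj₁ (eqF⁺ (sym same))))

  injective⇒resolved : (∀ u v → p u ≡ p v → u ≡ v) → ∀ f → ¬ T (unresolved f)
  injective⇒resolved p-inj f h = [ sameParts , inhomParts ] (T-∨⁻ h)
    where
    sameParts : ¬ T (eqF (p (R f)) (p (L f)))
    sameParts same = Fin.<-irrefl (sym (p-inj _ _ (eqF⁻ same))) (L<R f)
    inhomParts : ¬ T (inhom G p (p (L f)) (p (R f)))
    inhomParts inh =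
      let (u , u' , v , v' , u∈ , u'∈ , v∈ , v'∈ , uv , ¬u'v') = inhom⁻ inh
      in ¬u'v' (subst₂ (adjacent G) (p-inj _ _ (trans u∈ (sym u'∈))) (p-inj _ _ (trans v∈ (sym v'∈))) uv)

  nearParts : Fin m → Fin m → Bool
  nearParts X W = eqF X W ∨ interferes G p X W

  count-nearParts : ∀ X → count (nearParts X) ≤ suc (stretchOf G p X)
  count-nearParts X = ≤-trans (count-cover {Q = eqF X} {R = interferes G p X} (λ _ → T-∨⁻))
    (+-mono-≤ (count-unique {P = eqF X} (λ W W' X≡W X≡W' → trans (sym (eqF⁻ X≡W)) (eqF⁻ X≡W')))
              (≤-reflexive (sym (countF≡count (interferes G p X)))))

  inSpan⁺ : ∀ S {a b w} → T (S a) → T (S b) → a ≤ᶠ w → w ≤ᶠ b → T (inSpan G p S w)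
  inSpan⁺ S {a} {b} {w} Sa Sb a≤w w≤b =
    anyF⁺ (λ a → anyF (λ b → S a ∧ S b ∧ leF a w ∧ leF w b)) a
      (anyF⁺ (λ b → S a ∧ S b ∧ leF a w ∧ leF w b) b
        (∧-intro Sa (∧-intro Sb (∧-intro (leF⁺ a≤w) (leF⁺ w≤b)))))

  conflict⁺ : ∀ S S' {w} → T (inSpan G p S w) → T (inSpan G p S' w) → T (conflict G p S S')
  conflict⁺ S S' {w} Sw S'w = anyF⁺ (λ w → inSpan G p S w ∧ inSpan G p S' w) w (∧-intro Sw S'w)

  unresolved⇒inside-near : ∀ e → T (unresolved e) →
    ∀ v → L e <ᶠ v → v <ᶠ R e → T (nearParts (p (L e)) (p v))
  unresolved⇒inside-near e unres v Le<v v<Re with T? (eqF (p (L e)) (p v))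
  ... | yes same = T-∨⁺ (inj₁ same)
  ... | no differ = T-∨⁺ (inj₂ (∧-intro (T-not⁺ differ) (conflict⁺ partOfv nbhdUnion
          (inSpan⁺ partOfv (eqF⁺ refl) (eqF⁺ refl) Fin.≤-refl Fin.≤-refl)
          (inSpan⁺ nbhdUnion (T-∨⁺ {eqF (p (L e)) (p (L e))} (inj₁ (eqF⁺ refl))) unres
            (<⇒≤ Le<v) (<⇒≤ v<Re)))))
    where
    partOfv nbhdUnion : Fin n → Bool
    partOfv = inPart G p (p v)
    nbhdUnion = closedNbhdUnion G p (p (L e))

unresolved-in-one-part : ∀ {n} (G : OGraph n) (p : Fin n → Fin 1) e → T (unresolved G p e)
unresolved-in-one-part G p e = T-∨⁺ (inj₁ (eqF⁺ (Fin1-≡ (p (R e)) (p (L e)))))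
  where
  Fin1-≡ : (x y : Fin 1) → x ≡ y
  Fin1-≡ zero zero = refl

module Coarsening {n} {G : OGraph n} (S : PartitionSeq G) (k : ℕ) (k+1<n : suc k < n) where

  private
    fine : Fin n → Fin (suc (suc k))
    fine = part S (suc k)
    coarse : Fin n → Fin (suc k)
    coarse = part S k

  mergedˡ mergedʳ : Fin (suc (suc k))
  mergedˡ = proj₁ (merge S k k+1<n)
  mergedʳ = proj₁ (proj₂ (merge S k k+1<n))

  coarse≡⇔ : ∀ u v → (coarse u ≡ coarse v) ⇔
    (fine u ≡ fine v ⊎ ((fine u ≡ mergedˡ ⊎ fine u ≡ mergedʳ) × (fine v ≡ mergedˡ ⊎ fine v ≡ mergedʳ)))
  coarse≡⇔ = proj₂ (proj₂ (proj₂ (merge S k k+1<n)))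

  representative : Fin (suc (suc k)) → Fin n
  representative W = proj₁ (surj S (suc k) k+1<n W)

  fine-representative : ∀ W → fine (representative W) ≡ W
  fine-representative W = proj₂ (surj S (suc k) k+1<n W)

  coarsen : Fin (suc (suc k)) → Fin (suc k)
  coarsen W = coarse (representative W)

  coarsen-fine : ∀ v → coarsen (fine v) ≡ coarse v
  coarsen-fine v =
    Equivalence.from (coarse≡⇔ (representative (fine v)) v) (inj₁ (fine-representative (fine v)))

  coarsen-injective-off-mergedʳ : ∀ W W' → W ≢ mergedʳ → W' ≢ mergedʳ →
    coarsen W ≡ coarsen W' → W ≡ W'
  coarsen-injective-off-mergedʳ W W' W≢β W'≢β same
    with Equivalence.to (coarse≡⇔ (representative W) (representative W')) same
  ... | inj₁ sameFine = trans (sym (fine-representative W)) (trans sameFine (fine-representative W'))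
  ... | inj₂ (inj₁ W≡α , inj₁ W'≡α) =
          trans (sym (fine-representative W)) (trans W≡α (trans (sym W'≡α) (fine-representative W')))
  ... | inj₂ (inj₂ W≡β , _) = ⊥-elim (W≢β (trans (sym (fine-representative W)) W≡β))
  ... | inj₂ (_ , inj₂ W'≡β) = ⊥-elim (W'≢β (trans (sym (fine-representative W')) W'≡β))

  count-coarsen : ∀ (P : Fin (suc k) → Bool) → count (P ∘ coarsen) ≤ 1 + count P
  count-coarsen = count-∘-injective-off coarsen mergedʳ coarsen-injective-off-mergedʳ

count-neighbours : ∀ {n} {G : OGraph n} {d} → MaxDegreeAtMost G d → ∀ v → count (adj G v) ≤ d
count-neighbours {G = G} Δ≤d v = subst (_≤ _) (countF≡count (adj G v)) (Δ≤d v)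

module CrossingFamily {n} {G : OGraph n} {d} (Δ≤d : MaxDegreeAtMost G d) (e : Edge G)
  {N} (c : Fin N → Edge G) (c-distinct : ∀ i j → SameEdge (c i) (c j) → i ≡ j)
  (crosses : ∀ j → Cross e (c j)) where

  open Crossing e

  ι o : Fin N → Fin n
  ι j = inner (c j) (crosses j)
  o j = outer (c j) (crosses j)

  isInner : Fin n → Bool
  isInner v = anyF (λ j → eqF (ι j) v)

  N≤d*count-isInner : N ≤ d * count isInner
  N≤d*count-isInner = subst (_≤ d * count isInner) (count-all N)
    (count-fibres ι (λ j _ → anyF⁺ _ j (eqF⁺ refl)) sharingInner≤d)
    where
    sharingInner≤d : ∀ j → T true → count (λ j' → true ∧ eqF (ι j') (ι j)) ≤ d
    sharingInner≤d j _ = ≤-trans (count-injective o outerAdjacent outerInjective) (count-neighbours {G = G} Δ≤d (ι j))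
      where
      outerAdjacent : ∀ j' → T (true ∧ eqF (ι j') (ι j)) → adjacent G (ι j) (o j')
      outerAdjacent j' ι≡ = subst (λ v → adjacent G v (o j')) (eqF⁻ ι≡) (inner-outer-adjacent (c j') (crosses j'))
      outerInjective : ∀ j' j'' → T (true ∧ eqF (ι j') (ι j)) → T (true ∧ eqF (ι j'') (ι j)) →
        o j' ≡ o j'' → j' ≡ j''
      outerInjective j' j'' ι≡ ι≡' o≡ = c-distinct j' j''
        (inner-outer-injective (c j') (c j'') (crosses j') (crosses j'') (trans (eqF⁻ ι≡) (sym (eqF⁻ ι≡'))) o≡)

  module _ {m} (q : Fin n → Fin m) (resolved : ∀ j → ¬ T (unresolved G q (c j))) where

    outer-complete : ∀ j {u} → q u ≡ q (ι j) → adjacent G (o j) u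
    outer-complete j {u} u∈ with crosses j
    ... | inj₁ _ = adjacent-sym G (resolved⇒complete G q (c j) (resolved j) u∈ refl)
    ... | inj₂ _ = resolved⇒complete G q (c j) (resolved j) refl u∈

    count-isInner≤ : (Near : Fin m → Bool) → (∀ j → T (Near (q (ι j)))) → count isInner ≤ d * count Near
    count-isInner≤ Near near = count-fibres q
      (λ v inner → let (j , ι≡v) = anyF⁻ _ inner in subst (T ∘ Near ∘ q) (eqF⁻ ι≡v) (near j))
      partInner≤d
      where
      partInner≤d : ∀ v → T (isInner v) → count (λ v' → isInner v' ∧ eqF (q v') (q v)) ≤ d
      partInner≤d v inner = let (j , ι≡v) = anyF⁻ _ inner in
        ≤-trans (count-mono λ v' sameFinePart → outer-complete j
                   (trans (eqF⁻ (proj₂ (T-∧⁻ {isInner v'} sameFinePart))) (cong q (sym (eqF⁻ ι≡v)))))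
                (count-neighbours {G = G} Δ≤d (o j))

unresolved-level-bound : ∀ {n} {G : OGraph n} {d t} → MaxDegreeAtMost G d → (S : PartitionSeq G) →
  ∀ k → suc k < n → (∀ i → stretchOf G (part S k) i ≤ t) →
  ∀ e → T (unresolved G (part S k) e) →
  ∀ {N} (c : Fin N → Edge G) → (∀ i j → SameEdge (c i) (c j) → i ≡ j) → (∀ j → Cross e (c j)) →
  (∀ j → ¬ T (unresolved G (part S (suc k)) (c j))) →
  N ≤ d * (d * (2 + t))
unresolved-level-bound {n} {G} {d} {t} Δ≤d S k k+1<n stretch≤t e unres {N} c c-distinct crosses resolved = begin
  N                            ≤⟨ N≤d*count-isInner ⟩
  d * count isInner            ≤⟨ *-monoʳ-≤ d (count-isInner≤ (part S (suc k)) resolved nearFine nearι) ⟩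
  d * (d * count nearFine)     ≤⟨ *-monoʳ-≤ d (*-monoʳ-≤ d (count-coarsen nearX)) ⟩
  d * (d * (1 + count nearX))  ≤⟨ *-monoʳ-≤ d (*-monoʳ-≤ d (s≤s count-nearX≤)) ⟩
  d * (d * (2 + t))            ∎
  where
  open ≤-Reasoning
  open CrossingFamily Δ≤d e c c-distinct crosses
  open Coarsening S k k+1<n
  p : Fin n → Fin (suc k)
  p = part S k
  nearX : Fin (suc k) → Bool
  nearX = nearParts G p (p (L e))
  nearFine : Fin (suc (suc k)) → Bool
  nearFine = nearX ∘ coarsen
  count-nearX≤ : count nearX ≤ suc t
  count-nearX≤ = ≤-trans (count-nearParts G p (p (L e))) (s≤s (stretch≤t (p (L e))))
  nearι : ∀ j → T (nearFine (part S (suc k) (ι j)))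
  nearι j = subst (T ∘ nearX) (sym (coarsen-fine (ι j)))
    (unresolved⇒inside-near G p e unres (ι j) (proj₁ inside) (proj₂ inside))
    where
    inside : L e <ᶠ ι j × ι j <ᶠ R e
    inside = Crossing.inner-inside e (c j) (crosses j)

true-to-false-step : (B : ℕ → Bool) → T (B 0) → ∀ m → ¬ T (B m) →
  ∃[ k ] suc k ≤ m × T (B k) × ¬ T (B (suc k))
true-to-false-step B B0 zero ¬B0 = ⊥-elim (¬B0 B0)
true-to-false-step B B0 (suc m) ¬Bm+1 with T? (B m)
... | yes Bm = m , ≤-refl , Bm , ¬Bm+1
... | no ¬Bm = let (k , k+1≤m , Bk , ¬Bk+1) = true-to-false-step B B0 m ¬Bm
               in k , m≤n⇒m≤1+n k+1≤m , Bk , ¬Bk+1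

crossing-biclique-bound : ∀ {n} {G : OGraph n} {d t} → MaxDegreeAtMost G d → (S : PartitionSeq G) →
  (∀ k → k < n → ∀ i → stretchOf G (part S k) i ≤ t) →
  ∀ {N} (a b : Fin N → Edge G) →
  (∀ i j → SameEdge (a i) (a j) → i ≡ j) → (∀ i j → SameEdge (b i) (b j) → i ≡ j) →
  (∀ i j → Cross (a i) (b j)) → N ≤ d * (d * (2 + t))
crossing-biclique-bound Δ≤d S stretch≤t {zero} a b a-distinct b-distinct cross = z≤n
crossing-biclique-bound {zero} Δ≤d S stretch≤t {suc N} a b a-distinct b-distinct cross with L (a zero)
... | ()
-- With suc n vertices, part S 0 is the one-part partition and part S n the singletons.
crossing-biclique-bound {suc n} {G} {d} {t} Δ≤d S stretch≤t {suc N} a b a-distinct b-distinct cross =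
  let (k , k+1≤n , someAt-k , noneAt-k+1) =
        true-to-false-step someUnresolved someUnresolved-at-coarsest n noneUnresolved-at-finest
  in boundAt k k+1≤n (T-∨⁻ someAt-k) noneAt-k+1
  where
  unresolvedAt : ℕ → Edge G → Bool
  unresolvedAt k = unresolved G (part S k)
  someUnresolved : ℕ → Bool
  someUnresolved k = anyF (unresolvedAt k ∘ a) ∨ anyF (unresolvedAt k ∘ b)
  some-a : ∀ k i → T (unresolvedAt k (a i)) → T (someUnresolved k)
  some-a k i = T-∨⁺ {anyF (unresolvedAt k ∘ a)} ∘ inj₁ ∘ anyF⁺ (unresolvedAt k ∘ a) i
  some-b : ∀ k j → T (unresolvedAt k (b j)) → T (someUnresolved k)
  some-b k j = T-∨⁺ {anyF (unresolvedAt k ∘ a)} ∘ inj₂ ∘ anyF⁺ (unresolvedAt k ∘ b) j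
  someUnresolved-at-coarsest : T (someUnresolved 0)
  someUnresolved-at-coarsest = some-a 0 zero (unresolved-in-one-part G (part S 0) (a zero))
  noneUnresolved-at-finest : ¬ T (someUnresolved n)
  noneUnresolved-at-finest = [ noneIn a , noneIn b ] ∘ T-∨⁻ {anyF (unresolvedAt n ∘ a)}
    where
    noneIn : (c : Fin (suc N) → Edge G) → ¬ T (anyF (unresolvedAt n ∘ c))
    noneIn c some = let (i , unres) = anyF⁻ (unresolvedAt n ∘ c) some in
      injective⇒resolved G (part S n) (finest S n refl) (c i) unres
  boundAt : ∀ k → suc k ≤ n → T (anyF (unresolvedAt k ∘ a)) ⊎ T (anyF (unresolvedAt k ∘ b)) →
    ¬ T (someUnresolved (suc k)) → suc N ≤ d * (d * (2 + t))
  boundAt k k+1≤n (inj₁ someA) none = let (i , unres) = anyF⁻ (unresolvedAt k ∘ a) someA in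
    unresolved-level-bound Δ≤d S k (s≤s k+1≤n) (stretch≤t k (m≤n⇒m≤1+n k+1≤n)) (a i) unres
      b b-distinct (cross i) (λ j → none ∘ some-b (suc k) j)
  boundAt k k+1≤n (inj₂ someB) none = let (j , unres) = anyF⁻ (unresolvedAt k ∘ b) someB in
    unresolved-level-bound Δ≤d S k (s≤s k+1≤n) (stretch≤t k (m≤n⇒m≤1+n k+1≤n)) (b j) unres
      a a-distinct (λ i → cross-sym {e = a i} {b j} (cross i j)) (λ i → none ∘ some-a (suc k) i)

t+2<4t : ∀ {t} → 1 ≤ t → t + 2 < 4 * t
t+2<4t {t} 1≤t = +-monoʳ-< t (*-monoʳ-≤ 3 1≤t)

d²[2+t]<4td² : ∀ {d t} → 1 ≤ d → 1 ≤ t → d * (d * (2 + t)) < 4 * t * d ^ 2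
d²[2+t]<4td² {d@(suc _)} {t} _ 1≤t =
  subst₂ _<_ (regroup d t) (cong (λ x → 4 * t * (d * x)) (sym (*-identityʳ d))) (*-monoˡ-< (d * d) (t+2<4t 1≤t))
  where
  regroup : ∀ d t → (t + 2) * (d * d) ≡ d * (d * (2 + t))
  regroup = solve-∀

lemma25 : ∀ {n} (G : OGraph n) (d t : ℕ) → 1 ≤ d → 1 ≤ t →
    MaxDegreeAtMost G d → StwAtMost G t →
    ¬ OvContainsKNN G (4 * t * d ^ 2)
lemma25 G d t 1≤d 1≤t Δ≤d (S , stretch≤t) (a , b , a-distinct , b-distinct , _ , cross) =
  <⇒≱ (d²[2+t]<4td² 1≤d 1≤t) (crossing-biclique-bound Δ≤d S stretch≤t a b a-distinct b-distinct cross)
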